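{- Let $S,T\subseteq[r]$. If $S$ dominates $T$, then $T\subseteq S$.
   Context: For $\pi=a_1\cdots a_{r+1}\in S_{r+1}$ the descent set is $\{i\in[r]:a_i>a_{i+1}\}$ and $D(T)$ is the set of permutations in $S_{r+1}$ with descent set $T$. The inversion set is $I(\pi)=\{(a_i,a_j):i<j,\ a_i>a_j\}$, and the weak Bruhat order is $\pi\le_w\pi'$ iff $I(\pi)\subseteq I(\pi')$. $S$ dominates $T$ if there is an injection $\phi:D(T)\to D(S)$ with $\pi\le_w\phi(\pi)$ for all $\pi\in D(T)$. -}

module Defs where

open import Data.Nat using (ℕ; suc)
open import Data.Fin using (Fin; inject₁; _<_; _>_)
open import Data.Fin.Subset using (Subset; _∈_; _⊆_)
open import Data.Vec using (Vec; lookup)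
open import Data.Product using (Σ; ∃; ∃-syntax; _×_; proj₁)
open import Function.Definitions using (Injective)
open import Function.Bundles using (_⇔_)
open import Relation.Binary.PropositionalEquality using (_≡_)

-- A permutation of [n] in one-line notation a_1 ⋯ a_n (0-indexed here):
-- a word of length n over Fin n whose entries are pairwise distinct.
Perm : ℕ → Set
Perm n = Σ (Vec (Fin n) n) (λ w → Injective _≡_ _≡_ (lookup w))

word : ∀ {n} → Perm n → Vec (Fin n) n
word = proj₁

-- π ∈ S_{r+1} has a descent at position i ∈ [r] (positions i, i+1 in 1-based
-- notation are inject₁ i, suc i here): a_i > a_{i+1}.
Descent : ∀ {r} → Perm (suc r) → Fin r → Set
Descent π i = lookup (word π) (inject₁ i) > lookup (word π) (Fin.suc i)

HasDescentSet : ∀ {r} → Subset r → Perm (suc r) → Set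
HasDescentSet {r} T π = ∀ (i : Fin r) → (i ∈ T) ⇔ Descent π i

D : ∀ {r} → Subset r → Set
D {r} T = Σ (Perm (suc r)) (HasDescentSet T)

Inv : ∀ {n} → Perm n → Fin n → Fin n → Set
Inv π a b = ∃[ i ] ∃[ j ] (i < j × lookup (word π) i ≡ a × lookup (word π) j ≡ b × b < a)

_≤w_ : ∀ {n} → Perm n → Perm n → Set
π ≤w π' = ∀ a b → Inv π a b → Inv π' a b

-- S dominates T: an injection φ : D(T) → D(S) with π ≤w φ(π).
-- (Injectivity is on the underlying permutations, i.e. their one-line words.)
Dominates : ∀ {r} → Subset r → Subset r → Set
Dominates S T =
  Σ (D T → D S) λ φ →
    (∀ x y → word (proj₁ (φ x)) ≡ word (proj₁ (φ y)) → word (proj₁ x) ≡ word (proj₁ y))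
    × (∀ x → proj₁ x ≤w proj₁ (φ x))

-- Let i ∈ T and let π ∈ D(T) be the layered permutation of T, in which every letter
-- at a position ≤ i exceeds every letter after i.  All these pairs are inversions of
-- π, hence of σ = φ(π), so in σ the i+1 large letters precede the r−i small ones;
-- by pigeonhole they then fill exactly the first i+1 positions.  Thus σ has a
-- descent at i, and σ ∈ D(S) gives i ∈ S.
module Submission where

open import Defs
open import Data.Nat as ℕ using (ℕ; zero; suc; _∸_; _+_; z≤n; s≤s; s≤s⁻¹; z<s; s<s)
open import Data.Nat.Properties
  using (≤-trans; ≤-refl; ≤-reflexive; ≤-<-trans; <-≤-trans; <⇒≤; <⇒≱; ≮⇒≥; n≮n; n<1+n;
         m≤n+m; +-cancelʳ-≡; m≤o∸n⇒m+n≤o; ∸-monoˡ-<; ∸-monoʳ-<; ∸-cancelʳ-≡)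
open import Data.Fin as F using (Fin; zero; suc; toℕ; inject₁; fromℕ; fromℕ<; punchIn; punchOut)
open import Data.Fin.Properties
  using (toℕ<n; toℕ-injective; toℕ-inject₁; toℕ-fromℕ; toℕ-fromℕ<; injective⇒≤; <⇒notInjective;
         any?; _≟_; punchIn-injective; punchInᵢ≢i; punchOut-injective)
open import Data.Fin.Subset using (Subset; Side; inside; outside; _∈_; _⊆_)
open import Data.Vec using (_∷_; []; here; there; lookup; tabulate)
open import Data.Vec.Properties using (lookup∘tabulate)
open import Data.Product using (∃; _×_; _,_; proj₁; proj₂)
open import Function using (_∘_)
open import Function.Bundles using (_⇔_; mk⇔; module Equivalence)
open import Function.Definitions using (Injective; StrictlySurjective)
open import Relation.Binary.PropositionalEquality using (_≡_; refl; sym; trans; cong; subst; subst₂)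
open import Relation.Nullary using (contradiction; yes; no)

injective⇒strictlySurjective : ∀ {n} {f : Fin n → Fin n} →
  Injective _≡_ _≡_ f → StrictlySurjective _≡_ f
injective⇒strictlySurjective {suc n} {f} f-inj y with any? (λ x → f x ≟ y)
... | yes hit  = hit
... | no  miss = contradiction (λ {x} {x′} → squeeze-inj {x} {x′}) (<⇒notInjective (n<1+n n))
  where
  squeeze : Fin (suc n) → Fin n
  squeeze x = punchOut {i = y} (miss ∘ (x ,_) ∘ sym)
  squeeze-inj : Injective _≡_ _≡_ squeeze
  squeeze-inj {x} {x′} = f-inj ∘ punchOut-injective (miss ∘ (x ,_) ∘ sym) (miss ∘ (x′ ,_) ∘ sym)

interval-injective⇒≤ : ∀ {n m} {f : Fin n → Fin m} → Injective _≡_ _≡_ f →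
  ∀ {a b c d} → a ℕ.≤ b → b ℕ.≤ n →
  (∀ x → a ℕ.≤ toℕ x → toℕ x ℕ.< b → c ℕ.≤ toℕ (f x) × toℕ (f x) ℕ.< d) →
  b ∸ a ℕ.≤ d ∸ c
interval-injective⇒≤ {n} {f = f} f-inj {a} {b} {c} {d} a≤b b≤n maps = injective⇒≤ g-inj
  where
  shift<b : ∀ (j : Fin (b ∸ a)) → toℕ j + a ℕ.< b
  shift<b j = m≤o∸n⇒m+n≤o (suc (toℕ j)) a≤b (toℕ<n j)
  shift : Fin (b ∸ a) → Fin n
  shift j = fromℕ< (≤-trans (shift<b j) b≤n)
  toℕ-shift : ∀ j → toℕ (shift j) ≡ toℕ j + a
  toℕ-shift j = toℕ-fromℕ< (≤-trans (shift<b j) b≤n)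
  bounds : ∀ j → c ℕ.≤ toℕ (f (shift j)) × toℕ (f (shift j)) ℕ.< d
  bounds j = maps (shift j) (subst (a ℕ.≤_) (sym (toℕ-shift j)) (m≤n+m a (toℕ j)))
                            (subst (ℕ._< b) (sym (toℕ-shift j)) (shift<b j))
  g : Fin (b ∸ a) → Fin (d ∸ c)
  g j = fromℕ< (∸-monoˡ-< (proj₂ (bounds j)) (proj₁ (bounds j)))
  g-inj : Injective _≡_ _≡_ g
  g-inj {j} {j′} gj≡gj′ = toℕ-injective (+-cancelʳ-≡ a _ _
    (trans (sym (toℕ-shift j)) (trans (cong toℕ shift-eq) (toℕ-shift j′))))
    where
    shift-eq : shift j ≡ shift j′
    shift-eq = f-inj (toℕ-injective (∸-cancelʳ-≡ (proj₁ (bounds j)) (proj₁ (bounds j′))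
      (trans (sym (toℕ-fromℕ< _)) (trans (cong toℕ gj≡gj′) (toℕ-fromℕ< _)))))

initial-segment-preserved : ∀ {n} {τ : Fin n → Fin n} → Injective _≡_ _≡_ τ → ∀ m →
  (∀ k l → toℕ k ℕ.≤ m → m ℕ.< toℕ l → τ k F.< τ l) →
  ∀ k → toℕ k ℕ.≤ m ⇔ toℕ (τ k) ℕ.≤ m
initial-segment-preserved {n} {τ} τ-inj m ordered k = mk⇔ stays returns
  where
  stays : toℕ k ℕ.≤ m → toℕ (τ k) ℕ.≤ m
  stays k≤m = ≮⇒≥ λ m<τk →
    let 2+m≤n = ≤-<-trans m<τk (toℕ<n (τ k)) in
    <⇒≱ (∸-monoʳ-< (n<1+n (suc m)) 2+m≤n)
        (interval-injective⇒≤ τ-inj (<⇒≤ 2+m≤n) ≤-refl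
          (λ l m<l _ → ≤-<-trans m<τk (ordered k l k≤m m<l) , toℕ<n (τ l)))
  returns : toℕ (τ k) ℕ.≤ m → toℕ k ℕ.≤ m
  returns τk≤m = ≮⇒≥ λ m<k →
    n≮n m (interval-injective⇒≤ τ-inj z≤n (≤-trans m<k (<⇒≤ (toℕ<n k)))
      (λ j _ j<1+m → z≤n , <-≤-trans (ordered j k (s≤s⁻¹ j<1+m) m<k) τk≤m))

Separated : ∀ {n} → Perm n → ℕ → Set
Separated π m = ∀ k l → toℕ k ℕ.≤ m → m ℕ.< toℕ l → lookup (word π) l F.< lookup (word π) k

separated⇒descent : ∀ {r} (π σ : Perm (suc r)) (i : Fin r) →
  Separated π (toℕ i) → π ≤w σ → Descent σ i
separated⇒descent {r} π σ i sep π≤σ =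
  subst₂ F._<_ (proj₂ (entry (suc i))) (proj₂ (entry (inject₁ i))) (sep k l k≤i i<l)
  where
  p s : Fin (suc r) → Fin (suc r)
  p = lookup (word π)
  s = lookup (word σ)
  entry : ∀ u → ∃ λ k → p k ≡ s u
  entry u = injective⇒strictlySurjective (proj₂ π) (s u)
  pos : Fin (suc r) → Fin (suc r)
  pos a = proj₁ (injective⇒strictlySurjective (proj₂ σ) a)
  s∘pos : ∀ a → s (pos a) ≡ a
  s∘pos a = proj₂ (injective⇒strictlySurjective (proj₂ σ) a)
  pos-unique : ∀ {u a} → s u ≡ a → pos a ≡ u
  pos-unique {u} {a} su≡a = proj₂ σ (trans (s∘pos a) (sym su≡a))
  -- τ k is the position in σ of the letter at position k in π.
  τ : Fin (suc r) → Fin (suc r)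
  τ = pos ∘ p
  τ-inj : Injective _≡_ _≡_ τ
  τ-inj {k} {l} τk≡τl = proj₂ π (trans (sym (s∘pos (p k))) (trans (cong s τk≡τl) (s∘pos (p l))))
  τ-ordered : ∀ k l → toℕ k ℕ.≤ toℕ i → toℕ i ℕ.< toℕ l → τ k F.< τ l
  τ-ordered k l k≤i i<l with π≤σ (p k) (p l) (k , l , ≤-<-trans k≤i i<l , refl , refl , sep k l k≤i i<l)
  ... | u , v , u<v , su , sv , _ = subst₂ F._<_ (sym (pos-unique su)) (sym (pos-unique sv)) u<v
  segment : ∀ k → toℕ k ℕ.≤ toℕ i ⇔ toℕ (τ k) ℕ.≤ toℕ i
  segment = initial-segment-preserved τ-inj (toℕ i) τ-ordered
  k l : Fin (suc r)
  k = proj₁ (entry (inject₁ i))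
  l = proj₁ (entry (suc i))
  k≤i : toℕ k ℕ.≤ toℕ i
  k≤i = Equivalence.from (segment k)
    (≤-reflexive (trans (cong toℕ (pos-unique (sym (proj₂ (entry (inject₁ i)))))) (toℕ-inject₁ i)))
  i<l : toℕ i ℕ.< toℕ l
  i<l = ≮⇒≥ λ l<1+i → n≮n (toℕ i)
    (subst (ℕ._≤ toℕ i) (cong toℕ (pos-unique (sym (proj₂ (entry (suc i))))))
      (Equivalence.to (segment l) (s≤s⁻¹ l<1+i)))

punchIn-mono-< : ∀ {n} (i : Fin (suc n)) (j k : Fin n) → j F.< k → punchIn i j F.< punchIn i k
punchIn-mono-< zero    j       k       j<k       = s<s j<k
punchIn-mono-< (suc i) zero    (suc k) _         = z<s
punchIn-mono-< (suc i) (suc j) (suc k) (s<s j<k) = s<s (punchIn-mono-< i j k j<k)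

punchIn-cancel-< : ∀ {n} (i : Fin (suc n)) (j k : Fin n) → punchIn i j F.< punchIn i k → j F.< k
punchIn-cancel-< zero    j       k       (s<s j<k)   = j<k
punchIn-cancel-< (suc i) zero    zero    ()
punchIn-cancel-< (suc i) zero    (suc k) _           = z<s
punchIn-cancel-< (suc i) (suc j) (suc k) (s<s ↑j<↑k) = s<s (punchIn-cancel-< i j k ↑j<↑k)

punchIn-< : ∀ {n} (i : Fin (suc n)) (j : Fin n) → j F.< i → punchIn i j F.< i
punchIn-< (suc i) zero    _         = z<s
punchIn-< (suc i) (suc j) (s<s j<i) = s<s (punchIn-< i j j<i)

punchIn-<⁻¹ : ∀ {n} (i : Fin (suc n)) (j : Fin n) → punchIn i j F.< i → j F.< i
punchIn-<⁻¹ (suc i) zero    _         = z<s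
punchIn-<⁻¹ (suc i) (suc j) (s<s ↑j<i) = s<s (punchIn-<⁻¹ i j ↑j<i)

<-fromℕ : ∀ {n} (j : Fin (suc n)) → j F.< fromℕ (suc n)
<-fromℕ {n} j = subst (toℕ j ℕ.<_) (sym (toℕ-fromℕ (suc n))) (toℕ<n j)

lead : ∀ {n} → Side → Fin (suc n) → Fin (suc (suc n))
lead inside  _ = fromℕ _
lead outside x = inject₁ x

<-lead : ∀ {n} b {x : Fin (suc n)} (j : Fin (suc n)) → j F.< x → j F.< lead b x
<-lead inside      j _   = <-fromℕ j
<-lead outside {x} j j<x = subst (toℕ j ℕ.<_) (sym (toℕ-inject₁ x)) j<x

-- The layered permutation of T: increasing runs ending at the positions of T,
-- each run lying above all later ones.
layeredWord : ∀ {r} → Subset r → Fin (suc r) → Fin (suc r)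
layeredWord []      _       = zero
layeredWord (b ∷ T) zero    = lead b (layeredWord T zero)
layeredWord (b ∷ T) (suc k) = punchIn (lead b (layeredWord T zero)) (layeredWord T k)

layeredWord-injective : ∀ {r} (T : Subset r) → Injective _≡_ _≡_ (layeredWord T)
layeredWord-injective []      {zero}  {zero}  _ = refl
layeredWord-injective (b ∷ T) {zero}  {zero}  _ = refl
layeredWord-injective (b ∷ T) {zero}  {suc l} e = contradiction (sym e) (punchInᵢ≢i _ _)
layeredWord-injective (b ∷ T) {suc k} {zero}  e = contradiction e (punchInᵢ≢i _ _)
layeredWord-injective (b ∷ T) {suc k} {suc l} e =
  cong suc (layeredWord-injective T (punchIn-injective _ _ _ e))

layeredWord-separated : ∀ {r} (T : Subset r) {i} → i ∈ T → ∀ k l →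
  toℕ k ℕ.≤ toℕ i → toℕ i ℕ.< toℕ l → layeredWord T l F.< layeredWord T k
layeredWord-separated (inside ∷ T) here zero (suc l) _ _ =
  punchIn-< _ (layeredWord T l) (<-fromℕ _)
layeredWord-separated (b ∷ T) (there i∈T) zero (suc l) _ (s<s i<l) =
  punchIn-< _ (layeredWord T l) (<-lead b _ (layeredWord-separated T i∈T zero l z≤n i<l))
layeredWord-separated (b ∷ T) (there i∈T) (suc k) (suc l) (s≤s k≤i) (s<s i<l) =
  punchIn-mono-< _ _ _ (layeredWord-separated T i∈T k l k≤i i<l)

layeredWord-descent⇒∈ : ∀ {r} (T : Subset r) i →
  layeredWord T (suc i) F.< layeredWord T (inject₁ i) → i ∈ T
layeredWord-descent⇒∈ (inside  ∷ T) zero    _ = here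
layeredWord-descent⇒∈ (outside ∷ T) zero    d = contradiction
  (subst (toℕ w ℕ.<_) (toℕ-inject₁ w) (punchIn-<⁻¹ (inject₁ w) w d)) (n≮n (toℕ w))
  where w = layeredWord T zero
layeredWord-descent⇒∈ (b ∷ T) (suc i) d =
  there (layeredWord-descent⇒∈ T i (punchIn-cancel-< _ _ _ d))

lookup-layered : ∀ {r} (T : Subset r) k → lookup (tabulate (layeredWord T)) k ≡ layeredWord T k
lookup-layered T = lookup∘tabulate (layeredWord T)

layeredPerm : ∀ {r} → Subset r → Perm (suc r)
layeredPerm T = tabulate (layeredWord T) , λ {k} {l} e →
  layeredWord-injective T (trans (sym (lookup-layered T k)) (trans e (lookup-layered T l)))

layeredPerm-separated : ∀ {r} (T : Subset r) {i} → i ∈ T → Separated (layeredPerm T) (toℕ i)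
layeredPerm-separated T i∈T k l k≤i i<l =
  subst₂ F._<_ (sym (lookup-layered T l)) (sym (lookup-layered T k))
    (layeredWord-separated T i∈T k l k≤i i<l)

layeredPerm-descents : ∀ {r} (T : Subset r) → HasDescentSet T (layeredPerm T)
layeredPerm-descents T i = mk⇔
  (λ i∈T → layeredPerm-separated T i∈T (inject₁ i) (suc i) (≤-reflexive (toℕ-inject₁ i)) ≤-refl)
  (λ d → layeredWord-descent⇒∈ T i
    (subst₂ F._<_ (lookup-layered T (suc i)) (lookup-layered T (inject₁ i)) d))

proposition5p4 : (r : ℕ) (S T : Subset r) → Dominates S T → T ⊆ S
proposition5p4 r S T (φ , _ , φ-above) {i} i∈T =
  Equivalence.from (proj₂ (φ π) i)
    (separated⇒descent (proj₁ π) (proj₁ (φ π)) i (layeredPerm-separated T i∈T) (φ-above π))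
  where
  π : D T
  π = layeredPerm T , layeredPerm-descents T
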